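{- For every integer $n\ge 0$ there is a set $\mathrm{Paths}_n$ of centered paths, whose vertices are elements of $\mathrm{RV}^+_{n;2}$, such that the vertex sets $V(P)$, $P\in\mathrm{Paths}_n$, are pairwise disjoint with union $\mathrm{RV}^+_{n;2}$, and for every $P\in\mathrm{Paths}_n$: (i) $\mathrm{rad}(P)\equiv 0\pmod 2$; (ii) if $P(j)=T$ then $\mathrm{ind}(T)=j$; (iii) if $T\in V(P)$ then $\mathrm{rad}(P)=\mathrm{rad}(T)$.
   Context: Centered path: for an integer $r\ge 0$, a centered path $P$ of radius $\mathrm{rad}(P)=r$ consists of $r+1$ distinct vertices indexed $P(-r),P(-r+2),\dots,P(r-2),P(r)$ with directed edges $P(-r+2i)\to P(-r+2i+2)$ for $0\le i<r$; $V(P)$ is its vertex set. $\tau(i)=|i+1|-1$. For integers $r_1,r_2\ge 0$ and $x,y$: $\rho(r_1,r_2,x,y)=r_1+y$ if $y\ge -x+r_2-r_1$, and $\rho(r_1,r_2,x,y)=r_2-x$ if $y<-x+r_2-r_1$. Radius-value trees: a height-$0$ tree is a single vertex labeled by an even integer (its value). A height-$(n+1)$ tree is $T=(l,T_1,T_2,T_3)$ with $l$ even, $T_i$ radius-value trees of height $n$, and $|l-\mathrm{val}(T_1)-\mathrm{val}(T_3)|\le\tau(\mathrm{val}(T_2))$; $\mathrm{val}(T)=l$. $\mathrm{RV}_{n;2}$ is the set of height-$n$ trees all of whose leaves are labeled $2$. For $T\in\mathrm{RV}_{n;2}$, $\mathrm{ind}(T)=\mathrm{val}(T)-2^{n+1}$.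 The radius: $\mathrm{rad}(T)=0$ for height $0$; for trees $T_1,T_3$ put $\mathrm{rad}(T_1,T_3)=\rho(\mathrm{rad}(T_1),\mathrm{rad}(T_3),\mathrm{ind}(T_1),\mathrm{ind}(T_3))$, and for $T=(l,T_1,T_2,T_3)$ with $j=l-\mathrm{val}(T_1)-\mathrm{val}(T_3)$, $\mathrm{rad}(T)=\rho(\mathrm{rad}(T_1,T_3),\tau(\mathrm{val}(T_2)),\mathrm{ind}(T_1)+\mathrm{ind}(T_3),j)$. Define $\mathrm{RV}^+_{0;2}=\mathrm{RV}_{0;2}$ and, for $n\ge1$, $\mathrm{RV}^+_{n;2}$ is the set of $T=(l,T_1,T_2,T_3)\in\mathrm{RV}_{n;2}$ with $T_1,T_2,T_3\in\mathrm{RV}^+_{n-1;2}$ and $\mathrm{val}(T_2)\ge\max(\mathrm{rad}(T_2)-2^n,0)$. -}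

module Defs where

open import Data.Nat as ℕ using (ℕ; zero; suc)
open import Data.Integer as ℤ using (ℤ; +_; _+_; _-_; -_; _*_; _≤_; ∣_∣; _≤ᵇ_)
open import Data.Integer.Divisibility using (_∣_)
open import Data.Bool using (if_then_else_)
open import Data.Unit using (⊤)
open import Data.Fin using (Fin; toℕ)
open import Data.Product using (_×_)
open import Function.Definitions using (Injective)
open import Relation.Binary.PropositionalEquality using (_≡_)

τ : ℤ → ℤ
τ i = + ∣ i + + 1 ∣ - + 1

ρ : ℤ → ℤ → ℤ → ℤ → ℤ
ρ r₁ r₂ x y = if ((- x + r₂ - r₁) ≤ᵇ y) then r₁ + y else r₂ - x

data Tree : ℕ → Set where
  leaf : ℤ → Tree zero
  node : ∀ {n} → ℤ → Tree n → Tree n → Tree n → Tree (suc n)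

val : ∀ {n} → Tree n → ℤ
val (leaf l) = l
val (node l _ _ _) = l

Even : ℤ → Set
Even l = (+ 2) ∣ l

IsRV : ∀ {n} → Tree n → Set
IsRV (leaf l) = Even l
IsRV (node l T₁ T₂ T₃) =
  Even l × IsRV T₁ × IsRV T₂ × IsRV T₃ × (+ ∣ l - val T₁ - val T₃ ∣ ≤ τ (val T₂))

Leaves2 : ∀ {n} → Tree n → Set
Leaves2 (leaf l) = l ≡ + 2
Leaves2 (node l T₁ T₂ T₃) = Leaves2 T₁ × Leaves2 T₂ × Leaves2 T₃

RV2 : ∀ {n} → Tree n → Set
RV2 T = IsRV T × Leaves2 T

ind : ∀ {n} → Tree n → ℤ
ind {n} T = val T - + (2 ℕ.^ suc n)

rad : ∀ {n} → Tree n → ℤ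
rad (leaf _) = + 0
rad (node l T₁ T₂ T₃) =
  ρ (ρ (rad T₁) (rad T₃) (ind T₁) (ind T₃))
    (τ (val T₂))
    (ind T₁ + ind T₃)
    (l - val T₁ - val T₃)

Plus : ∀ {n} → Tree n → Set
Plus (leaf _) = ⊤
Plus {suc n} (node l T₁ T₂ T₃) =
  Plus T₁ × Plus T₂ × Plus T₃ × ((rad T₂ - + (2 ℕ.^ suc n)) ℤ.⊔ + 0 ≤ val T₂)

RVPlus2 : ∀ {n} → Tree n → Set
RVPlus2 T = RV2 T × Plus T

-- Centered path of radius r with vertices in Tree n:
-- vertex i stands for P(-r + 2i), i = 0..r; vertices pairwise distinct.
record CenteredPath (n : ℕ) : Set where
  field
    radius   : ℕ
    vertex   : Fin (suc radius) → Tree n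
    distinct : Injective _≡_ _≡_ vertex

open CenteredPath public

pos : ∀ {n} (P : CenteredPath n) → Fin (suc (radius P)) → ℤ
pos P i = - (+ radius P) + + 2 * + toℕ i

{-# OPTIONS --safe #-}
-- A tree of
-- height n+1 is a label l with children T₁, T₂, T₃ ∈ RV⁺, and admissibility
-- forces val T₂ ≥ 0, so τ (val T₂) = val T₂ and the jump l - val T₁ - val T₃
-- runs over the even integers of absolute value at most val T₂: a centered
-- path of radius val T₂.  Once T₂ and the paths through T₁ and T₃ are fixed,
-- the trees therefore form a product of three centered paths along which ind
-- is the sum of the three indices.  A product of two centered paths of radii
-- r₁, r₂ is a disjoint union of hooks, each a centered path for the summed
-- index whose radius is ρ (r₁, r₂, x, y) at every vertex (x, y) of it, which
-- is exactly how rad combines the children.  Cutting the triple product into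
-- hooks twice yields the paths at height n+1; their radii r₁ + r₂ - 2k stay
-- even.
module Submission where

open import Defs
open import Data.Nat using (ℕ; suc)
open import Data.Nat.Divisibility using (_∣_)
open import Data.Integer using (+_)
open import Data.Fin using (Fin)
open import Data.Product using (Σ; _×_; ∃; ∃₂; _,_)
open import Relation.Binary.PropositionalEquality using (_≡_)

open import Data.Nat.Divisibility using (divides)
open import Data.Product using (proj₁; proj₂)
open import Data.Bool using (true; false)
open import Data.Sum using ([_,_]′)
open import Data.Unit using (⊤; tt)
open import Data.Empty using (⊥-elim)
open import Function using (_∘_)
open import Function.Definitions using (Injective)
open import Relation.Binary.PropositionalEquality
open ≡-Reasoning
open import Relation.Nullary.Decidable using (recompute)
import Data.Nat as ℕ
import Data.Nat.Properties as ℕ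
import Data.Nat.Divisibility as ℕ
import Data.Nat.Tactic.RingSolver as ℕ-Ring
import Data.Integer as ℤ
import Data.Integer.Properties as ℤ
import Data.Integer.Tactic.RingSolver as ℤ-Ring
import Data.Fin as Fin
import Data.Fin.Properties as Fin
open import Data.Integer.Divisibility.Signed
  using (∣ᵤ⇒∣; ∣⇒∣ᵤ; ∣-refl; ∣m∣n⇒∣m+n; ∣m∣n⇒∣m-n; ∣m⇒∣-m; ∣m⇒∣m*n)
open import Algebra.Properties.CommutativeSemigroup ℕ.+-commutativeSemigroup
  using (x∙yz≈y∙xz; xy∙z≈yz∙x)
open import Algebra.Properties.AbelianGroup ℤ.+-0-abelianGroup using (∙-cancelˡ)

≡-recompute : ∀ {m n : ℕ} → .(m ≡ n) → m ≡ n
≡-recompute {m} {n} = recompute (m ℕ.≟ n)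

module _ where
  open import Data.Nat using (zero; _+_; _≤_)

  data Split (c e : ℕ) : Set where
    below : (d : ℕ) → c + suc d ≡ e → Split c e
    above : (s : ℕ) → e + s ≡ c → Split c e

  split : ∀ c e → Split c e
  split zero      zero      = above 0 refl
  split zero      (suc e)   = below e refl
  split (suc c)   zero      = above (suc c) refl
  split (suc c)   (suc e) with split c e
  ... | below d eq = below d (cong suc eq)
  ... | above s eq = above s (cong suc eq)

  split-below : ∀ c d → split c (c + suc d) ≡ below d refl
  split-below zero    d = refl
  split-below (suc c) d rewrite split-below c d = refl

  split-above : ∀ e s → split (e + s) e ≡ above s refl
  split-above zero    zero    = refl
  split-above zero    (suc s) = refl
  split-above (suc e) s rewrite split-above e s = refl

  -- A vertex of a centered path of radius r, written P (index p) in the paper.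
  -- Storing `after` as well keeps the hook bijection free of truncated
  -- subtraction.
  record Pos (r : ℕ) : Set where
    constructor mkPos
    field
      before after : ℕ
      .total : before + after ≡ r
  open Pos public

  before≤ : ∀ {r} (p : Pos r) → before p ≤ r
  before≤ (mkPos a a' t) = subst (a ≤_) (≡-recompute t) (ℕ.m≤m+n a a')

  Pos-≡ : ∀ {r} {p q : Pos r} → before p ≡ before q → p ≡ q
  Pos-≡ {p = mkPos a a' t} {mkPos .a b' u} refl
    with ℕ.+-cancelˡ-≡ a a' b' (trans (≡-recompute t) (sym (≡-recompute u)))
  ... | refl = refl

  -- Pos r₁ × Pos r₂ (coordinates `before`) is the disjoint union of the hooks
  -- with corner k ≤ min r₁ r₂: the column {k} × [0, r₂ - k) followed by the
  -- row [k, r₁] × {r₂ - k}.  Each step along a hook raises the sum of the two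
  -- indices by 2, so a hook is a centered path of radius (r₁ - k) + (r₂ - k).
  record Hook (r₁ r₂ : ℕ) : Set where
    constructor hook
    field
      corner arm₁ arm₂ : ℕ
      .closes₁ : corner + arm₁ ≡ r₁
      .closes₂ : corner + arm₂ ≡ r₂

  hookRadius : ∀ {r₁ r₂} → Hook r₁ r₂ → ℕ
  hookRadius h = Hook.arm₁ h + Hook.arm₂ h

  HookPos : ℕ → ℕ → Set
  HookPos r₁ r₂ = Σ (Hook r₁ r₂) λ h → Pos (hookRadius h)

  fromHook : ∀ {r₁ r₂} → HookPos r₁ r₂ → Pos r₁ × Pos r₂
  fromHook (hook k e₁ e₂ ke₁ ke₂ , mkPos c c' cc') with split c e₂
  ... | below d refl = mkPos k e₁ ke₁ , mkPos c (k + suc d) (trans (x∙yz≈y∙xz c k (suc d)) ke₂)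
  ... | above s refl = mkPos (k + s) c' (trans (ℕ.+-assoc k s c') (trans (cong (λ m → k + m) s+c'≡e₁) ke₁))
                     , mkPos e₂ k (trans (ℕ.+-comm e₂ k) ke₂)
    where
    s+c'≡e₁ : s + c' ≡ e₁
    s+c'≡e₁ = ℕ.+-cancelˡ-≡ e₂ _ _
                (trans (sym (ℕ.+-assoc e₂ s c')) (trans (≡-recompute cc') (ℕ.+-comm e₁ e₂)))

  toHook : ∀ {r₁ r₂} → Pos r₁ × Pos r₂ → HookPos r₁ r₂
  toHook (mkPos a a' aa' , mkPos b b' bb') with split a b'
  ... | below d refl = hook a a' (b + suc d) aa' (trans (x∙yz≈y∙xz a b (suc d)) bb')
                     , mkPos b (a' + suc d) (x∙yz≈y∙xz b a' (suc d))
  ... | above s refl = hook b' (s + a') b (trans (sym (ℕ.+-assoc b' s a')) aa') (trans (ℕ.+-comm b' b) bb')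
                     , mkPos (b + s) a' (xy∙z≈yz∙x b s a')

  fromHook-toHook : ∀ {r₁ r₂} (x : Pos r₁ × Pos r₂) → fromHook (toHook x) ≡ x
  fromHook-toHook (mkPos a a' _ , mkPos b b' _) with split a b'
  ... | below d refl rewrite split-below b d = refl
  ... | above s refl rewrite split-above b s = refl

  toHook-fromHook : ∀ {r₁ r₂} (x : HookPos r₁ r₂) → toHook (fromHook x) ≡ x
  toHook-fromHook (hook k e₁ e₂ _ _ , mkPos c c' cc') with split c e₂
  ... | below d refl
    with ℕ.+-cancelˡ-≡ c c' (e₁ + suc d) (trans (≡-recompute cc') (x∙yz≈y∙xz e₁ c (suc d)))
  ...   | refl rewrite split-below k d = refl
  toHook-fromHook (hook k e₁ e₂ _ _ , mkPos c c' cc') | above s refl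
    with ℕ.+-cancelˡ-≡ e₂ e₁ (s + c')
           (trans (ℕ.+-comm e₂ e₁) (trans (sym (≡-recompute cc')) (ℕ.+-assoc e₂ s c')))
  ...   | refl rewrite split-above k s = refl

module _ where
  open import Data.Integer using (ℤ; -_; _+_; _-_; _*_; _≤_; _<_; ∣_∣; _≤ᵇ_)

  index : ∀ {r} → Pos r → ℤ
  index {r} p = - + r + + 2 * + before p

  index-injective : ∀ {r} {p q : Pos r} → index p ≡ index q → p ≡ q
  index-injective {r} {p} {q} eq =
    Pos-≡ (ℤ.+-injective (ℤ.*-cancelˡ-≡ (+ 2) (+ before p) (+ before q) (∙-cancelˡ (- + r) _ _ eq)))

  ∣index∣≤radius : ∀ {r} (p : Pos r) → ∣ index p ∣ ℕ.≤ r
  ∣index∣≤radius (mkPos a a' t) with ≡-recompute t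
  ... | refl = subst (λ i → ∣ i ∣ ℕ.≤ a ℕ.+ a') (identity (+ a) (+ a')) (ℤ.∣i-j∣≤∣i∣+∣j∣ (+ a) (+ a'))
    where
    identity : ∀ a a' → a - a' ≡ - (a + a') + + 2 * a
    identity = ℤ-Ring.solve-∀

  Even-+ : ∀ {i j} → Even i → Even j → Even (i + j)
  Even-+ {i} {j} 2∣i 2∣j =
    ∣⇒∣ᵤ {+ 2} {i + j} (∣m∣n⇒∣m+n {+ 2} {i} {j} (∣ᵤ⇒∣ {+ 2} {i} 2∣i) (∣ᵤ⇒∣ {+ 2} {j} 2∣j))

  Even-- : ∀ {i j} → Even i → Even j → Even (i - j)
  Even-- {i} {j} 2∣i 2∣j =
    ∣⇒∣ᵤ {+ 2} {i - j} (∣m∣n⇒∣m-n {+ 2} {i} {j} (∣ᵤ⇒∣ {+ 2} {i} 2∣i) (∣ᵤ⇒∣ {+ 2} {j} 2∣j))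

  Even-index : ∀ {r} → 2 ∣ r → (p : Pos r) → Even (index p)
  Even-index {r} 2∣r p = Even-+ { - + r} {+ 2 * + before p}
    (∣⇒∣ᵤ {+ 2} { - + r} (∣m⇒∣-m {+ 2} {+ r} (∣ᵤ⇒∣ {+ 2} {+ r} 2∣r)))
    (∣⇒∣ᵤ {+ 2} {+ 2 * + before p} (∣m⇒∣m*n {+ 2} {+ 2} (+ before p) ∣-refl))

  index-surjective : ∀ {r j} → 2 ∣ r → Even j → ∣ j ∣ ℕ.≤ r → ∃ λ (p : Pos r) → index p ≡ j
  index-surjective {j = j} (divides w refl) (divides u ∣j∣≡u*2) ∣j∣≤r
    with ℕ.m≤n⇒∃[o]m+o≡n (ℕ.*-cancelʳ-≤ u w 2 (subst (ℕ._≤ w ℕ.* 2) ∣j∣≡u*2 ∣j∣≤r))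
  ... | t , refl = [ at-+∣j∣ , at--∣j∣ ]′ (ℤ.+∣i∣≡i⊎+∣i∣≡-i j)
    where
    r≡ : + ((u ℕ.+ t) ℕ.* 2) ≡ (+ u + + t) * + 2
    r≡ = ℤ.pos-* (u ℕ.+ t) 2
    u*2≡∣j∣ : + u * + 2 ≡ + ∣ j ∣
    u*2≡∣j∣ = trans (sym (ℤ.pos-* u 2)) (cong +_ (sym ∣j∣≡u*2))
    ℕ-identity : ∀ u t → t ℕ.+ (u ℕ.+ t ℕ.+ u) ≡ (u ℕ.+ t) ℕ.* 2
    ℕ-identity = ℕ-Ring.solve-∀
    identity₊ : ∀ u t → - ((u + t) * + 2) + + 2 * (u + t + u) ≡ u * + 2
    identity₊ = ℤ-Ring.solve-∀
    identity₋ : ∀ u t → - ((u + t) * + 2) + + 2 * t ≡ - (u * + 2)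
    identity₋ = ℤ-Ring.solve-∀
    at-+∣j∣ : + ∣ j ∣ ≡ j → ∃ λ (p : Pos ((u ℕ.+ t) ℕ.* 2)) → index p ≡ j
    at-+∣j∣ +∣j∣≡j = mkPos (u ℕ.+ t ℕ.+ u) t (trans (ℕ.+-comm _ t) (ℕ-identity u t)) , (begin
      - + ((u ℕ.+ t) ℕ.* 2) + + 2 * + (u ℕ.+ t ℕ.+ u) ≡⟨ cong (λ z → - z + + 2 * + (u ℕ.+ t ℕ.+ u)) r≡ ⟩
      - ((+ u + + t) * + 2) + + 2 * + (u ℕ.+ t ℕ.+ u) ≡⟨ identity₊ (+ u) (+ t) ⟩
      + u * + 2                                       ≡⟨ trans u*2≡∣j∣ +∣j∣≡j ⟩
      j                                               ∎)
    at--∣j∣ : + ∣ j ∣ ≡ - j → ∃ λ (p : Pos ((u ℕ.+ t) ℕ.* 2)) → index p ≡ j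
    at--∣j∣ +∣j∣≡-j = mkPos t (u ℕ.+ t ℕ.+ u) (ℕ-identity u t) , (begin
      - + ((u ℕ.+ t) ℕ.* 2) + + 2 * + t               ≡⟨ cong (λ z → - z + + 2 * + t) r≡ ⟩
      - ((+ u + + t) * + 2) + + 2 * + t               ≡⟨ identity₋ (+ u) (+ t) ⟩
      - (+ u * + 2)                                   ≡⟨ cong -_ (trans u*2≡∣j∣ +∣j∣≡-j) ⟩
      - - j                                           ≡⟨ ℤ.neg-involutive j ⟩
      j                                               ∎)

  τ-+ : ∀ v → τ (+ v) ≡ + v
  τ-+ v = identity (+ v)
    where
    identity : ∀ v → v + + 1 - + 1 ≡ v
    identity = ℤ-Ring.solve-∀

  ρ-≥ : ∀ r₁ r₂ x y m → y ≡ (- x + r₂ - r₁) + + m → ρ r₁ r₂ x y ≡ r₁ + y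
  ρ-≥ r₁ r₂ x y m y≡t+m with - x + r₂ - r₁ ≤ᵇ y | ℤ.≤⇒≤ᵇ t≤y
    where
    t≤y : - x + r₂ - r₁ ≤ y
    t≤y = subst (- x + r₂ - r₁ ≤_) (sym y≡t+m) (ℤ.i≤i+j (- x + r₂ - r₁) (+ m))
  ... | true | _ = refl

  ρ-< : ∀ r₁ r₂ x y m → - x + r₂ - r₁ ≡ y + + suc m → ρ r₁ r₂ x y ≡ r₂ - x
  ρ-< r₁ r₂ x y m t≡y+1+m with - x + r₂ - r₁ ≤ᵇ y | ℤ.≤ᵇ⇒≤ { - x + r₂ - r₁} {y}
  ... | false | _      = refl
  ... | true  | ≤ᵇ⇒≤ = ⊥-elim (ℤ.<⇒≱ y<t (≤ᵇ⇒≤ _))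
    where
    y<t : y < - x + r₂ - r₁
    y<t = subst (_< _) (ℤ.+-identityʳ y) (subst (_ <_) (sym t≡y+1+m) (ℤ.+-monoʳ-< y (ℤ.+<+ ℕ.z<s)))

  index-fromHook : ∀ {r₁ r₂} (x : HookPos r₁ r₂) →
                   let (p , q) = fromHook x in index p + index q ≡ index (proj₂ x)
  index-fromHook (hook k e₁ e₂ ke₁ ke₂ , mkPos c _ _) with ≡-recompute ke₁ | ≡-recompute ke₂
  ... | refl | refl with split c e₂
  ...   | below d refl = identity (+ k) (+ e₁) (+ c) (+ d)
    where
    identity : ∀ k e₁ c d → (- (k + e₁) + + 2 * k) + (- (k + (c + (+ 1 + d))) + + 2 * c)
                            ≡ - (e₁ + (c + (+ 1 + d))) + + 2 * c
    identity = ℤ-Ring.solve-∀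
  ...   | above s refl = identity (+ k) (+ e₁) (+ e₂) (+ s)
    where
    identity : ∀ k e₁ e₂ s → (- (k + e₁) + + 2 * (k + s)) + (- (k + e₂) + + 2 * e₂)
                             ≡ - (e₁ + e₂) + + 2 * (e₂ + s)
    identity = ℤ-Ring.solve-∀

  ρ-fromHook : ∀ {r₁ r₂} (x : HookPos r₁ r₂) →
               let (p , q) = fromHook x in ρ (+ r₁) (+ r₂) (index p) (index q) ≡ + hookRadius (proj₁ x)
  ρ-fromHook (hook k e₁ e₂ ke₁ ke₂ , mkPos c _ _) with ≡-recompute ke₁ | ≡-recompute ke₂
  ... | refl | refl with split c e₂
  ...   | below d refl =
    trans (ρ-< R₁ R₂ (- R₁ + + 2 * + k) (- R₂ + + 2 * + c)
               (suc (d ℕ.+ d)) (threshold (+ k) (+ e₁) (+ c) (+ d)))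
          (hookRadius-identity (+ k) (+ e₁) (+ c) (+ d))
    where
    R₁ = + (k ℕ.+ e₁)
    R₂ = + (k ℕ.+ e₂)
    threshold : ∀ k e₁ c d → - (- (k + e₁) + + 2 * k) + (k + (c + (+ 1 + d))) - (k + e₁)
                             ≡ (- (k + (c + (+ 1 + d))) + + 2 * c) + (+ 1 + (+ 1 + (d + d)))
    threshold = ℤ-Ring.solve-∀
    hookRadius-identity : ∀ k e₁ c d → (k + (c + (+ 1 + d))) - (- (k + e₁) + + 2 * k)
                                       ≡ e₁ + (c + (+ 1 + d))
    hookRadius-identity = ℤ-Ring.solve-∀
  ...   | above s refl =
    trans (ρ-≥ R₁ R₂ (- R₁ + + 2 * + (k ℕ.+ s)) (- R₂ + + 2 * + e₂)
               (s ℕ.+ s) (threshold (+ k) (+ e₁) (+ e₂) (+ s)))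
          (hookRadius-identity (+ k) (+ e₁) (+ e₂))
    where
    R₁ = + (k ℕ.+ e₁)
    R₂ = + (k ℕ.+ e₂)
    threshold : ∀ k e₁ e₂ s → - (k + e₂) + + 2 * e₂
                              ≡ - (- (k + e₁) + + 2 * (k + s)) + (k + e₂) - (k + e₁) + (s + s)
    threshold = ℤ-Ring.solve-∀
    hookRadius-identity : ∀ k e₁ e₂ → (k + e₁) + (- (k + e₂) + + 2 * e₂) ≡ e₁ + e₂
    hookRadius-identity = ℤ-Ring.solve-∀

hookRadius-even : ∀ {r₁ r₂} (h : Hook r₁ r₂) → 2 ∣ r₁ → 2 ∣ r₂ → 2 ∣ hookRadius h
hookRadius-even (hook k e₁ e₂ ke₁ ke₂) 2∣r₁ 2∣r₂ with ≡-recompute ke₁ | ≡-recompute ke₂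
... | refl | refl =
  ℕ.∣m+n∣m⇒∣n (subst (2 ∣_) (identity k e₁ e₂) (ℕ.∣m∣n⇒∣m+n 2∣r₁ 2∣r₂)) (divides k refl)
  where
  identity : ∀ k e₁ e₂ → k ℕ.+ e₁ ℕ.+ (k ℕ.+ e₂) ≡ k ℕ.* 2 ℕ.+ (e₁ ℕ.+ e₂)
  identity = ℕ-Ring.solve-∀

node-injective : ∀ {n l l'} {T₁ T₂ T₃ T₁' T₂' T₃' : Tree n} →
                 node l T₁ T₂ T₃ ≡ node l' T₁' T₂' T₃' → l ≡ l' × T₁ ≡ T₁' × T₂ ≡ T₂' × T₃ ≡ T₃'
node-injective refl = refl , refl , refl , refl

Even-val : ∀ {k} (T : Tree k) → IsRV T → Even (val T)
Even-val (leaf l)       even-l       = even-l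
Even-val (node l _ _ _) (even-l , _) = even-l

record CenteredPartition (n : ℕ) : Set₁ where
  field
    Index    : Set
    radiusOf : Index → ℕ

  Vertex : Set
  Vertex = Σ Index λ h → Pos (radiusOf h)

  field
    tree            : Vertex → Tree n
    tree-RV⁺        : ∀ x → RVPlus2 (tree x)
    tree-injective  : Injective _≡_ _≡_ tree
    tree-surjective : ∀ T → RVPlus2 T → ∃ λ x → tree x ≡ T
    radiusOf-even   : ∀ h → 2 ∣ radiusOf h
    ind-tree        : ∀ h p → ind (tree (h , p)) ≡ index p
    rad-tree        : ∀ h p → rad (tree (h , p)) ≡ + radiusOf h

Pos₀-before : (p : Pos 0) → before p ≡ 0
Pos₀-before (mkPos a a' t) = ℕ.m+n≡0⇒m≡0 a (≡-recompute t)

partition₀ : CenteredPartition 0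
partition₀ = record
  { Index           = ⊤
  ; radiusOf        = λ _ → 0
  ; tree            = λ _ → leaf (+ 2)
  ; tree-RV⁺        = λ _ → (divides 1 refl , refl) , tt
  ; tree-injective  = λ {(_ , p)} {(_ , q)} _ →
      cong (tt ,_) (Pos-≡ (trans (Pos₀-before p) (sym (Pos₀-before q))))
  ; tree-surjective = λ { (leaf l) ((_ , l≡2) , _) → (tt , mkPos 0 0 refl) , cong leaf (sym l≡2) }
  ; radiusOf-even   = λ _ → divides 0 refl
  ; ind-tree        = λ _ p → cong (λ a → ℤ.- + 0 ℤ.+ + 2 ℤ.* + a) (sym (Pos₀-before p))
  ; rad-tree        = λ _ _ → refl
  }

module Extend {n : ℕ} (P : CenteredPartition n) where
  open CenteredPartition P
  open import Data.Integer using (ℤ; -_; _+_; _-_; _*_; _≤_; _⊔_; ∣_∣)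

  Admissible : Tree n → Set
  Admissible T = (rad T - + (2 ℕ.^ suc n)) ⊔ + 0 ≤ val T

  record Middle : Set where
    constructor middle
    field
      centre      : Vertex
      .admissible : Admissible (tree centre)
  open Middle

  admissible-recomputed : (m : Middle) → Admissible (tree (centre m))
  admissible-recomputed (middle _ adm) = recompute (_ ℤ.≤? _) adm

  width : Middle → ℕ
  width m = ∣ val (tree (centre m)) ∣

  +width≡val : ∀ m → + width m ≡ val (tree (centre m))
  +width≡val m = ℤ.0≤i⇒+∣i∣≡i (ℤ.≤-trans (ℤ.i≤j⊔i _ (+ 0)) (admissible-recomputed m))

  τ-val≡width : ∀ m → τ (val (tree (centre m))) ≡ + width m
  τ-val≡width m = trans (cong τ (sym (+width≡val m))) (τ-+ (width m))

  record Children : Set where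
    constructor children
    field
      mid         : Middle
      left right  : Vertex
      shift       : Pos (width mid)

  build : Children → Tree (suc n)
  build (children m x₁ x₃ j) =
    node (val (tree x₁) + val (tree x₃) + index j) (tree x₁) (tree (centre m)) (tree x₃)

  cancel-sides : ∀ v₁ v₃ j → v₁ + v₃ + j - v₁ - v₃ ≡ j
  cancel-sides = ℤ-Ring.solve-∀

  build-RV⁺ : ∀ t → RVPlus2 (build t)
  build-RV⁺ (children m@(middle x₂ _) x₁ x₃ j)
    with tree-RV⁺ x₁ | tree-RV⁺ x₂ | tree-RV⁺ x₃
  ... | (rv₁ , two₁) , plus₁ | (rv₂ , two₂) , plus₂ | (rv₃ , two₃) , plus₃ =
    ( ( Even-+ {val (tree x₁) + val (tree x₃)} {index j}
               (Even-+ {val (tree x₁)} {val (tree x₃)} (Even-val _ rv₁) (Even-val _ rv₃))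
               (Even-index (Even-val _ rv₂) j)
      , rv₁ , rv₂ , rv₃ , bound)
    , (two₁ , two₂ , two₃))
    , (plus₁ , plus₂ , plus₃ , admissible-recomputed m)
    where
    bound : + ∣ val (tree x₁) + val (tree x₃) + index j - val (tree x₁) - val (tree x₃) ∣
            ≤ τ (val (tree x₂))
    bound = subst₂ (λ i k → + ∣ i ∣ ≤ k)
                   (sym (cancel-sides (val (tree x₁)) (val (tree x₃)) (index j))) (sym (τ-val≡width m))
                   (ℤ.+≤+ (∣index∣≤radius j))

  build-injective : Injective _≡_ _≡_ build
  build-injective {children (middle x₂ _) x₁ x₃ j} {children (middle x₂' _) x₁' x₃' j'} eq
    with node-injective eq
  ... | l≡l' , t₁≡t₁' , t₂≡t₂' , t₃≡t₃'
    with tree-injective t₁≡t₁' | tree-injective t₂≡t₂' | tree-injective t₃≡t₃'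
  ... | refl | refl | refl =
    cong (children _ x₁ x₃) (index-injective (∙-cancelˡ (val (tree x₁) + val (tree x₃)) _ _ l≡l'))

  build-surjective : ∀ T → RVPlus2 T → ∃ λ t → build t ≡ T
  build-surjective (node l T₁ T₂ T₃)
    (((even-l , rv₁ , rv₂ , rv₃ , bound) , (two₁ , two₂ , two₃)) , (plus₁ , plus₂ , plus₃ , adm))
    with tree-surjective T₁ ((rv₁ , two₁) , plus₁)
       | tree-surjective T₂ ((rv₂ , two₂) , plus₂)
       | tree-surjective T₃ ((rv₃ , two₃) , plus₃)
  ... | x₁ , refl | x₂ , refl | x₃ , refl =
    children m x₁ x₃ (proj₁ shift) , cong (λ l' → node l' _ _ _) label
    where
    m = middle x₂ adm
    v₁ = val (tree x₁)
    v₃ = val (tree x₃)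
    shift : ∃ λ (j : Pos (width m)) → index j ≡ l - v₁ - v₃
    shift = index-surjective (Even-val _ rv₂)
                             (Even-- {l - v₁} {v₃} (Even-- {l} {v₁} even-l (Even-val _ rv₁)) (Even-val _ rv₃))
                             (ℤ.drop‿+≤+ (subst (+ ∣ l - v₁ - v₃ ∣ ≤_) (τ-val≡width m) bound))
    identity : ∀ v₁ v₃ l → v₁ + v₃ + (l - v₁ - v₃) ≡ l
    identity = ℤ-Ring.solve-∀
    label : v₁ + v₃ + index (proj₁ shift) ≡ l
    label = trans (cong (λ i → v₁ + v₃ + i) (proj₂ shift)) (identity v₁ v₃ l)

  ind-build : ∀ t → let open Children t in
              ind (build t) ≡ ind (tree left) + ind (tree right) + index shift
  ind-build (children m x₁ x₃ j) = identity (val (tree x₁)) (val (tree x₃)) (index j) (+ (2 ℕ.^ suc n))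
    where
    identity : ∀ v₁ v₃ i p → v₁ + v₃ + i - (p + (p + + 0)) ≡ (v₁ - p) + (v₃ - p) + i
    identity = ℤ-Ring.solve-∀

  rad-build : ∀ t → let open Children t in
              rad (build t) ≡ ρ (ρ (rad (tree left)) (rad (tree right)) (ind (tree left)) (ind (tree right)))
                                (+ width mid) (ind (tree left) + ind (tree right)) (index shift)
  rad-build (children m x₁ x₃ j) =
    cong₂ (λ w i → ρ (ρ (rad T₁) (rad T₃) (ind T₁) (ind T₃)) w (ind T₁ + ind T₃) i)
          (τ-val≡width m) (cancel-sides (val T₁) (val T₃) (index j))
    where
    T₁ = tree x₁
    T₃ = tree x₃

  record Index⁺ : Set where
    constructor index⁺
    field
      mid        : Middle
      left right : Index
      inner      : Hook (radiusOf left) (radiusOf right)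
      outer      : Hook (hookRadius inner) (width mid)

  radius⁺ : Index⁺ → ℕ
  radius⁺ h = hookRadius (Index⁺.outer h)

  unpack : (h : Index⁺) → Pos (radius⁺ h) → Children
  unpack (index⁺ m h₁ h₃ s₁ s₂) p =
    let (p₁₃ , j) = fromHook (s₂ , p)
        (p₁ , p₃) = fromHook (s₁ , p₁₃)
    in children m (h₁ , p₁) (h₃ , p₃) j

  pack : Children → Σ Index⁺ (Pos ∘ radius⁺)
  pack (children m (h₁ , p₁) (h₃ , p₃) j) =
    let (s₁ , p₁₃) = toHook (p₁ , p₃)
        (s₂ , p)   = toHook (p₁₃ , j)
    in index⁺ m h₁ h₃ s₁ s₂ , p

  pack-unpack : ∀ h p → pack (unpack h p) ≡ (h , p)
  pack-unpack (index⁺ m h₁ h₃ s₁ s₂) p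
    rewrite toHook-fromHook (s₁ , proj₁ (fromHook (s₂ , p))) | toHook-fromHook (s₂ , p) = refl

  unpack-pack : ∀ t → let (h , p) = pack t in unpack h p ≡ t
  unpack-pack (children m (h₁ , p₁) (h₃ , p₃) j)
    rewrite fromHook-toHook (proj₂ (toHook (p₁ , p₃)) , j) | fromHook-toHook (p₁ , p₃) = refl

  ind-fromHook : ∀ h₁ h₃ (x : HookPos (radiusOf h₁) (radiusOf h₃)) → let (p₁ , p₃) = fromHook x in
                ind (tree (h₁ , p₁)) + ind (tree (h₃ , p₃)) ≡ index (proj₂ x)
  ind-fromHook h₁ h₃ x =
    trans (cong₂ _+_ (ind-tree h₁ (proj₁ (fromHook x))) (ind-tree h₃ (proj₂ (fromHook x)))) (index-fromHook x)

  rad-fromHook : ∀ h₁ h₃ (x : HookPos (radiusOf h₁) (radiusOf h₃)) → let (p₁ , p₃) = fromHook x in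
                 ρ (rad (tree (h₁ , p₁))) (rad (tree (h₃ , p₃))) (ind (tree (h₁ , p₁))) (ind (tree (h₃ , p₃)))
                 ≡ + hookRadius (proj₁ x)
  rad-fromHook h₁ h₃ x = begin
    ρ (rad T₁) (rad T₃) (ind T₁) (ind T₃)
      ≡⟨ cong₂ (λ r₁ r₃ → ρ r₁ r₃ (ind T₁) (ind T₃)) (rad-tree h₁ p₁) (rad-tree h₃ p₃) ⟩
    ρ (+ radiusOf h₁) (+ radiusOf h₃) (ind T₁) (ind T₃)
      ≡⟨ cong₂ (ρ (+ radiusOf h₁) (+ radiusOf h₃)) (ind-tree h₁ p₁) (ind-tree h₃ p₃) ⟩
    ρ (+ radiusOf h₁) (+ radiusOf h₃) (index p₁) (index p₃)
      ≡⟨ ρ-fromHook x ⟩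
    + hookRadius (proj₁ x)
      ∎
    where
    p₁ = proj₁ (fromHook x)
    p₃ = proj₂ (fromHook x)
    T₁ = tree (h₁ , p₁)
    T₃ = tree (h₃ , p₃)

  ind-tree⁺ : ∀ h p → ind (build (unpack h p)) ≡ index p
  ind-tree⁺ h@(index⁺ m h₁ h₃ s₁ s₂) p =
    trans (ind-build (unpack h p))
          (trans (cong (_+ index j) (ind-fromHook h₁ h₃ (s₁ , p₁₃))) (index-fromHook (s₂ , p)))
    where
    p₁₃ = proj₁ (fromHook (s₂ , p))
    j   = proj₂ (fromHook (s₂ , p))

  rad-tree⁺ : ∀ h p → rad (build (unpack h p)) ≡ + radius⁺ h
  rad-tree⁺ h@(index⁺ m h₁ h₃ s₁ s₂) p =
    trans (rad-build (unpack h p))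
          (trans (cong₂ (λ r i → ρ r (+ width m) i (index j))
                        (rad-fromHook h₁ h₃ (s₁ , p₁₃)) (ind-fromHook h₁ h₃ (s₁ , p₁₃)))
                 (ρ-fromHook (s₂ , p)))
    where
    p₁₃ = proj₁ (fromHook (s₂ , p))
    j   = proj₂ (fromHook (s₂ , p))

  partition-suc : CenteredPartition (suc n)
  partition-suc = record
    { Index           = Index⁺
    ; radiusOf        = radius⁺
    ; tree            = λ (h , p) → build (unpack h p)
    ; tree-RV⁺        = λ (h , p) → build-RV⁺ (unpack h p)
    ; tree-injective  = λ {(h , p)} {(h' , p')} eq →
        trans (sym (pack-unpack h p))
              (trans (cong pack (build-injective {unpack h p} {unpack h' p'} eq)) (pack-unpack h' p'))
    ; tree-surjective = λ T rv → let (t , eq) = build-surjective T rv in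
        pack t , trans (cong build (unpack-pack t)) eq
    ; radiusOf-even   = λ (index⁺ m h₁ h₃ s₁ s₂) →
        hookRadius-even s₂ (hookRadius-even s₁ (radiusOf-even h₁) (radiusOf-even h₃))
                        (Even-val _ (proj₁ (proj₁ (tree-RV⁺ (centre m)))))
    ; ind-tree        = ind-tree⁺
    ; rad-tree        = rad-tree⁺
    }

partition : ∀ n → CenteredPartition n
partition ℕ.zero = partition₀
partition (suc n) = Extend.partition-suc (partition n)

toPos : ∀ {r} → Fin (suc r) → Pos r
toPos {r} i = mkPos (Fin.toℕ i) (r ℕ.∸ Fin.toℕ i) (ℕ.m+[n∸m]≡n (Fin.toℕ≤pred[n] i))

fromPos : ∀ {r} → Pos r → Fin (suc r)
fromPos p = Fin.fromℕ< (ℕ.s≤s (before≤ p))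

toPos-fromPos : ∀ {r} (p : Pos r) → toPos (fromPos p) ≡ p
toPos-fromPos p = Pos-≡ (Fin.toℕ-fromℕ< (ℕ.s≤s (before≤ p)))

theorem5p3 : (n : ℕ) →
    Σ Set λ I → Σ (I → CenteredPath n) λ Paths →
      ((p : I) (i : Fin (suc (radius (Paths p)))) → RVPlus2 (vertex (Paths p) i))
      × ((T : Tree n) → RVPlus2 T → ∃₂ λ (p : I) (i : Fin (suc (radius (Paths p)))) → vertex (Paths p) i ≡ T)
      × ((p q : I) (i : Fin (suc (radius (Paths p)))) (j : Fin (suc (radius (Paths q)))) →
           vertex (Paths p) i ≡ vertex (Paths q) j → p ≡ q)
      × ((p : I) →
           (2 ∣ radius (Paths p))
           × ((i : Fin (suc (radius (Paths p)))) → ind (vertex (Paths p) i) ≡ pos (Paths p) i)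
           × ((i : Fin (suc (radius (Paths p)))) → + radius (Paths p) ≡ rad (vertex (Paths p) i)))
theorem5p3 n =
  Index , path ,
  (λ h i → tree-RV⁺ (h , toPos i)) ,
  (λ T rv → let ((h , p) , eq) = tree-surjective T rv in
     h , fromPos p , trans (cong (λ q → tree (h , q)) (toPos-fromPos p)) eq) ,
  (λ _ _ _ _ eq → cong proj₁ (tree-injective eq)) ,
  (λ h → radiusOf-even h , (λ i → ind-tree h (toPos i)) , (λ i → sym (rad-tree h (toPos i))))
  where
  open CenteredPartition (partition n)
  path : Index → CenteredPath n
  path h = record
    { radius   = radiusOf h
    ; vertex   = λ i → tree (h , toPos i)
    ; distinct = λ eq → Fin.toℕ-injective (cong (before ∘ proj₂) (tree-injective eq))
    }
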